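{- Let $G$ be a connected graph and $c$ a charge function such that $T(G,c)$ is satisfiable. Let $\{v_1,\dots,v_k\}$ be an independent set of $G$. For each $i\in[k]$ let $(N^i_1,N^i_2)$ be a partition of $N(v_i)$ with both parts nonempty, let $c_i\in\{0,1\}$, and let $\chi'_{v_i}:\sum_{u\in N^i_1}x_{uv_i}\equiv c_i\pmod 2$. If the graph obtained from $G$ by splitting every $v_i$ along $(N^i_1,N^i_2)$ is connected, then the formula $T(G,c)\land\chi'_{v_1}\land\dots\land\chi'_{v_k}$ has exactly $2^{|E(G)|-|V(G)|-k+1}$ models.
   Context: Graphs are finite and simple. $N(v)$ is the set of neighbors of $v$, $E(v)$ the set of incident edges. For $c:V(G)\to\{0,1\}$, $T(G,c)$ has variables $x_e$ ($e\in E(G)$) and is the conjunction of the constraints $\sum_{e\in E(u)}x_e\equiv c(u)\pmod 2$, $u\in V(G)$; models are assignments to $\{x_e:e\in E(G)\}$. Splitting $v$ along a partition $(N_1,N_2)$ of $N(v)$ with nonempty parts: delete $v$, add new vertices $v^1,v^2$, join $v^1$ to all of $N_1$ and $v^2$ to all of $N_2$. Since the $v_i$ are pairwise non-adjacent, the splittings can be performed successively in any order. -}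

module Defs where

open import Data.Nat using (ℕ; zero; suc)
open import Data.Fin using (Fin; zero; suc; _≟_)
open import Data.Bool using (Bool; true; false; _xor_; _∧_; if_then_else_)
open import Data.List using (List; []; _∷_; concatMap; foldr; filter; length; allFin)
import Data.Vec.Functional as VF
open import Data.Maybe using (Maybe; just; nothing)
open import Data.Product using (_×_; _,_; proj₁; proj₂; ∃)
open import Data.Sum using (_⊎_; inj₁; inj₂)
open import Relation.Binary.PropositionalEquality using (_≡_; _≢_)
open import Relation.Nullary.Decidable using (⌊_⌋)

-- Graphs given by an edge list: vertex type V, edges indexed by Fin m,
-- edge e joins  proj₁ (ends e)  and  proj₂ (ends e)  (unordered).

Adj : {V : Set} {m : ℕ} → (Fin m → V × V) → V → V → Set
Adj ends u w = ∃ λ e → (ends e ≡ (u , w)) ⊎ (ends e ≡ (w , u))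

record SimpleGraph (n m : ℕ) (ends : Fin m → Fin n × Fin n) : Set where
  field
    noLoop : ∀ e → proj₁ (ends e) ≢ proj₂ (ends e)
    noMulti : ∀ e e' → (ends e ≡ ends e') ⊎
                       (ends e ≡ (proj₂ (ends e') , proj₁ (ends e'))) → e ≡ e'

data Reach {V : Set} {m : ℕ} (ends : Fin m → V × V) (u : V) : V → Set where
  here : Reach ends u u
  step : ∀ {w x} → Reach ends u w → Adj ends w x → Reach ends u x

Connected : (V : Set) {m : ℕ} → (Fin m → V × V) → Set
Connected V ends = V × (∀ a b → Reach ends a b)

-- Tseitin formulas.  Assignments x : Fin m → Bool (true = 1).

incident : {n m : ℕ} → (Fin m → Fin n × Fin n) → Fin m → Fin n → Bool
incident ends e u with ⌊ proj₁ (ends e) ≟ u ⌋ | ⌊ proj₂ (ends e) ≟ u ⌋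
... | false | false = false
... | _ | _ = true

parityWhere : {m : ℕ} → (Fin m → Bool) → (Fin m → Bool) → Bool
parityWhere {m} p x = foldr (λ e acc → if p e then x e xor acc else acc) false (allFin m)

_==_ : Bool → Bool → Bool
true == b = b
false == true = false
false == false = true

allB : {n : ℕ} → (Fin n → Bool) → Bool
allB {n} f = foldr (λ i acc → f i ∧ acc) true (allFin n)

satT : {n m : ℕ} → (Fin m → Fin n × Fin n) → (Fin n → Bool) → (Fin m → Bool) → Bool
satT ends c x = allB (λ u → parityWhere (λ e → incident ends e u) x == c u)

-- the other endpoint of e seen from v (meaningful when e is incident to v)
other : {n m : ℕ} → (Fin m → Fin n × Fin n) → Fin m → Fin n → Fin n
other ends e v with ⌊ proj₁ (ends e) ≟ v ⌋
... | true = proj₂ (ends e)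
... | false = proj₁ (ends e)

-- χ'_v : Σ_{u ∈ N₁} x_{uv} ≡ cv (mod 2), where N₁ = {u ∈ N(v) | inN1 u = true}
satChi : {n m : ℕ} → (Fin m → Fin n × Fin n) → Fin n → (Fin n → Bool) → Bool →
         (Fin m → Bool) → Bool
satChi ends v inN1 cv x =
  parityWhere (λ e → incident ends e v ∧ inN1 (other ends e v)) x == cv

allAssign : (m : ℕ) → List (Fin m → Bool)
allAssign zero = (λ ()) ∷ []
allAssign (suc m) = concatMap (λ x → (false VF.∷ x) ∷ (true VF.∷ x) ∷ []) (allAssign m)

countModels : (m : ℕ) → ((Fin m → Bool) → Bool) → ℕ
countModels m φ = length (filter (λ x → φ x ≡? true) (allAssign m))
  where
  open import Data.Bool using () renaming (_≟_ to _≡?_)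

-- Vertex set of the split graph: Fin n ⊎ Fin k, where
--   inj₁ u   (u not among the vs)  is u itself,
--   inj₁ (vs i)                    is v_i^1 (joined to N^i_1),
--   inj₂ i                         is v_i^2 (joined to N^i_2).
-- Every edge of G gives exactly one edge of the split graph.

findIdx : {n : ℕ} (k : ℕ) → (Fin k → Fin n) → Fin n → Maybe (Fin k)
findIdx zero vs a = nothing
findIdx (suc k) vs a with ⌊ vs zero ≟ a ⌋
... | true = just zero
... | false with findIdx k (λ i → vs (suc i)) a
...   | just i = just (suc i)
...   | nothing = nothing

newEnd : {n k : ℕ} → (Fin k → Fin n) → (Fin k → Fin n → Bool) →
         Fin n → Fin n → Fin n ⊎ Fin k
newEnd {k = k} vs N1 a b with findIdx k vs a
... | nothing = inj₁ a
... | just i = if N1 i b then inj₁ a else inj₂ i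

splitEnds : {n m k : ℕ} → (Fin m → Fin n × Fin n) → (Fin k → Fin n) →
            (Fin k → Fin n → Bool) → Fin m → (Fin n ⊎ Fin k) × (Fin n ⊎ Fin k)
splitEnds ends vs N1 e =
  newEnd vs N1 (proj₁ (ends e)) (proj₂ (ends e)) ,
  newEnd vs N1 (proj₂ (ends e)) (proj₁ (ends e))

module Submission where

-- Over GF(2), write ∂x for the vector of vertex parities of an edge set x, so that the models of
-- T(G,c) are the solutions of ∂x = c.  By the handshake lemma ∂x always has even weight, and when G
-- is connected every even vector is some ∂x (sum the edge sets of walks from a fixed root).  So the
-- fibres of ∂ over the 2^(|V|-1) even vectors are translates of each other and each has
-- 2^(|E|-|V|+1) elements.  Splitting v_i replaces its constraint and χ'_{v_i} by the constraints at
-- v_i^1 (the edges into N^i_1, charge c_i) and v_i^2 (the other edges, charge c(v_i) + c_i); this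
-- charge still has even weight, so the formula is a satisfiable Tseitin formula of the connected
-- split graph, which has |V(G)| + k vertices and |E(G)| edges.

open import Defs
open import Algebra.Bundles using (CommutativeMonoid; CommutativeRing)
open import Data.Bool as Bool using (Bool; true; false; not; _∧_; _∨_; _xor_; if_then_else_; T)
open import Data.Bool.Properties
  using ( xor-∧-commutativeRing; ∧-commutativeMonoid; ∧-assoc; ∧-identityʳ; ∧-zeroʳ; ∨-identityʳ
        ; xor-identityʳ; xor-assoc; xor-comm; xor-same; ∧-distribˡ-xor; T-≡; ⇔→≡)
open import Data.Empty using (⊥-elim)
open import Data.Fin using (Fin; zero; suc; _≟_; join; splitAt)
open import Data.Fin.Properties as Fin using (splitAt-join; join-splitAt)
open import Data.List using (List; []; _∷_; foldr; filter; length; concatMap; tabulate)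
open import Data.Maybe using (just; nothing; maybe′)
open import Data.Nat using (ℕ; zero; suc; _+_; _*_; _∸_; _^_)
open import Data.Nat.Properties using (+-comm; +-suc; +-identityʳ; *-assoc; *-cancelˡ-≡; m+1+n≢0; suc-injective)
open import Data.Product as Product using (_×_; _,_; proj₁; proj₂; ∃)
open import Data.Product.Function.NonDependent.Propositional using (_×-⇔_)
open import Data.Sum as Sum using (_⊎_; inj₁; inj₂)
open import Data.Vec.Functional as Vector using (Vector)
open import Data.Vec.Functional.Properties using (≗-dec)
open import Function using (_∘_; _⇔_; mk⇔; Equivalence)
open import Function.Construct.Symmetry using (⇔-sym)
open import Function.Definitions using (Injective)
open import Function.Related.Propositional using (module EquationalReasoning; Kind)
open import Relation.Binary.Core using (_Preserves_⟶_)
open import Relation.Binary.PropositionalEquality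
open import Relation.Nullary using (¬_)
open import Relation.Nullary.Decidable
  using (Dec; yes; no; does; ⌊_⌋; isYes≗does; does-⇔; dec-false; _×-dec_; T?)
open import Algebra.Properties.Semiring.Sum (CommutativeRing.semiring xor-∧-commutativeRing)
  using (sum; sum-syntax; sum-cong-≗; ∑-comm; ∑-distrib-+; *-distribˡ-sum; *-distribʳ-sum; sum-replicate-zero)
open import Algebra.Properties.CommutativeSemigroup (CommutativeMonoid.commutativeSemigroup ∧-commutativeMonoid)
  using (x∙yz≈y∙xz)

open Equivalence using (to; from)

xor-involutiveʳ : ∀ a b → (a xor b) xor b ≡ a
xor-involutiveʳ false false = refl
xor-involutiveʳ false true  = refl
xor-involutiveʳ true  false = refl
xor-involutiveʳ true  true  = refl

xor-cancelˡ : ∀ a b → a xor (a xor b) ≡ b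
xor-cancelˡ a b = trans (sym (xor-assoc a a b)) (cong (_xor b) (xor-same a))

xor≡⇔≡xor : ∀ {a b c} → a xor b ≡ c ⇔ a ≡ c xor b
xor≡⇔≡xor {a} {b} {c} = mk⇔ (λ eq → trans (sym (xor-involutiveʳ a b)) (cong (_xor b) eq))
                            (λ eq → trans (cong (_xor b) eq) (xor-involutiveʳ c b))

==⇔≡ : ∀ {a b} → (a == b) ≡ true ⇔ a ≡ b
==⇔≡ {false} {false} = mk⇔ (λ _ → refl) (λ _ → refl)
==⇔≡ {false} {true}  = mk⇔ (λ ()) (λ ())
==⇔≡ {true}  {false} = mk⇔ (λ ()) (λ ())
==⇔≡ {true}  {true}  = mk⇔ (λ _ → refl) (λ _ → refl)

∧≡true⇔ : ∀ {a b} → a ∧ b ≡ true ⇔ (a ≡ true × b ≡ true)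
∧≡true⇔ {true}  {true}  = mk⇔ (λ _ → refl , refl) (λ _ → refl)
∧≡true⇔ {true}  {false} = mk⇔ (λ ()) (λ ())
∧≡true⇔ {false}         = mk⇔ (λ ()) (λ ())

∀-cong-⇔ : {I : Set} {A B : I → Set} → (∀ i → A i ⇔ B i) → (∀ i → A i) ⇔ (∀ i → B i)
∀-cong-⇔ A⇔B = mk⇔ (λ a i → to (A⇔B i) (a i)) (λ b i → from (A⇔B i) (b i))

does⇔ : {A : Set} (a? : Dec A) → does a? ≡ true ⇔ A
does⇔ (yes a)  = mk⇔ (λ _ → a) (λ _ → refl)
does⇔ (no ¬a) = mk⇔ (λ ()) (λ a → ⊥-elim (¬a a))

⌊⌋-⇔ : {A B : Set} → A ⇔ B → (a? : Dec A) (b? : Dec B) → ⌊ a? ⌋ ≡ ⌊ b? ⌋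
⌊⌋-⇔ A⇔B a? b? = trans (isYes≗does a?) (trans (does-⇔ A⇔B a? b?) (sym (isYes≗does b?)))

⌊≟⌋-comm : ∀ {n} (i j : Fin n) → ⌊ i ≟ j ⌋ ≡ ⌊ j ≟ i ⌋
⌊≟⌋-comm i j = ⌊⌋-⇔ (mk⇔ sym sym) (i ≟ j) (j ≟ i)

∑-zero : ∀ {n} {f : Fin n → Bool} → (∀ i → f i ≡ false) → ∑[ i < n ] f i ≡ false
∑-zero {n} f≗0 = trans (sum-cong-≗ f≗0) (sum-replicate-zero n)

∑-δ : ∀ {n} (f : Fin n → Bool) (j : Fin n) → ∑[ i < n ] (f i ∧ ⌊ i ≟ j ⌋) ≡ f j
∑-δ f zero = trans (cong₂ _xor_ (∧-identityʳ (f zero)) (∑-zero (λ i → ∧-zeroʳ (f (suc i)))))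
                   (xor-identityʳ (f zero))
∑-δ f (suc j) = trans (cong₂ _xor_ (∧-zeroʳ (f zero)) (sum-cong-≗ λ i →
                         cong (f (suc i) ∧_) (⌊⌋-⇔ (mk⇔ Fin.suc-injective (cong suc)) (suc i ≟ suc j) (i ≟ j))))
                      (∑-δ (f ∘ suc) j)

∑-⌊≟⌋ : ∀ {n} (v : Fin n) → ∑[ u < n ] ⌊ v ≟ u ⌋ ≡ true
∑-⌊≟⌋ v = trans (sum-cong-≗ (⌊≟⌋-comm v)) (∑-δ (λ _ → true) v)

∑-splitAt : ∀ n k (g : Fin n ⊎ Fin k → Bool) →
            ∑[ w < n + k ] g (splitAt n w) ≡ ∑[ u < n ] g (inj₁ u) xor ∑[ i < k ] g (inj₂ i)
∑-splitAt zero    k g = refl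
∑-splitAt (suc n) k g = trans (cong (g (inj₁ zero) xor_) (∑-splitAt n k (g ∘ Sum.map₁ suc)))
                              (sym (xor-assoc (g (inj₁ zero)) _ _))

allB⇔ : ∀ {n} (f : Fin n → Bool) → allB f ≡ true ⇔ (∀ i → f i ≡ true)
allB⇔ {n} f = go n (λ i → i)
  where
  go : ∀ k (g : Fin k → Fin n) → foldr (λ i acc → f i ∧ acc) true (tabulate g) ≡ true ⇔ (∀ i → f (g i) ≡ true)
  go zero    g = mk⇔ (λ _ ()) (λ _ → refl)
  go (suc k) g with f (g zero) in fg₀
  ... | true  = mk⇔ (λ h → λ { zero → fg₀ ; (suc i) → to (go k (g ∘ suc)) h i })
                    (λ h → from (go k (g ∘ suc)) (h ∘ suc))
  ... | false = mk⇔ (λ ()) (λ h → trans (sym fg₀) (h zero))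

parityWhere≡∑ : ∀ {m} (p x : Fin m → Bool) → parityWhere p x ≡ ∑[ e < m ] (p e ∧ x e)
parityWhere≡∑ {m} p x = go m (λ i → i)
  where
  go : ∀ k (g : Fin k → Fin m) →
       foldr (λ e acc → if p e then x e xor acc else acc) false (tabulate g) ≡ ∑[ i < k ] (p (g i) ∧ x (g i))
  go zero    g = refl
  go (suc k) g with p (g zero)
  ... | true  = cong (x (g zero) xor_) (go k (g ∘ suc))
  ... | false = go k (g ∘ suc)

allB-parityWhere⇔ : ∀ {n m} (p : Fin n → Fin m → Bool) (c : Fin n → Bool) x →
                    allB (λ u → parityWhere (p u) x == c u) ≡ true ⇔ (∀ u → ∑[ e < m ] (p u e ∧ x e) ≡ c u)
allB-parityWhere⇔ p c x = begin
  allB (λ u → parityWhere (p u) x == c u) ≡ true  ∼⟨ allB⇔ _ ⟩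
  (∀ u → (parityWhere (p u) x == c u) ≡ true)     ∼⟨ ∀-cong-⇔ (λ u → ==⇔≡) ⟩
  (∀ u → parityWhere (p u) x ≡ c u)               ∼⟨ ∀-cong-⇔ (λ u → mk⇔ (trans (sym (parityWhere≡∑ (p u) x)))
                                                                          (trans (parityWhere≡∑ (p u) x))) ⟩
  (∀ u → ∑[ e < _ ] (p u e ∧ x e) ≡ c u)          ∎
  where open EquationalReasoning {k = Kind.equivalence}

-- Counting models

private
  count : {A : Set} → (A → Bool) → List A → ℕ
  count P []       = 0
  count P (x ∷ xs) = if P x then suc (count P xs) else count P xs

  length-filter≡count : {A : Set} (P : A → Bool) (xs : List A) →
                        length (filter (λ x → P x Bool.≟ true) xs) ≡ count P xs
  length-filter≡count P [] = refl
  length-filter≡count P (x ∷ xs) with P x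
  ... | true  = cong suc (length-filter≡count P xs)
  ... | false = length-filter≡count P xs

  count-cong : {A : Set} {P Q : A → Bool} (xs : List A) → (∀ x → P x ≡ Q x) → count P xs ≡ count Q xs
  count-cong [] _ = refl
  count-cong {Q = Q} (x ∷ xs) P≗Q rewrite P≗Q x with Q x
  ... | true  = cong suc (count-cong xs P≗Q)
  ... | false = count-cong xs P≗Q

  count-pairs : {A B : Set} (P : B → Bool) (f g : A → B) (xs : List A) →
                count P (concatMap (λ x → f x ∷ g x ∷ []) xs) ≡ count (P ∘ f) xs + count (P ∘ g) xs
  count-pairs P f g [] = refl
  count-pairs P f g (x ∷ xs) with P (f x) | P (g x)
  ... | true  | true  = cong suc (trans (cong suc (count-pairs P f g xs)) (sym (+-suc _ _)))
  ... | true  | false = cong suc (count-pairs P f g xs)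
  ... | false | true  = trans (cong suc (count-pairs P f g xs)) (sym (+-suc _ _))
  ... | false | false = count-pairs P f g xs

  count-split : {A : Set} (P Q : A → Bool) (xs : List A) →
                count P xs ≡ count (λ x → P x ∧ Q x) xs + count (λ x → P x ∧ not (Q x)) xs
  count-split P Q [] = refl
  count-split P Q (x ∷ xs) with P x | Q x
  ... | false | _     = count-split P Q xs
  ... | true  | true  = cong suc (count-split P Q xs)
  ... | true  | false = trans (cong suc (count-split P Q xs)) (sym (+-suc _ _))

numModels : ∀ m → (Vector Bool m → Bool) → ℕ
numModels m P = count P (allAssign m)

countModels≡numModels : ∀ m P → countModels m P ≡ numModels m P
countModels≡numModels m P = length-filter≡count P (allAssign m)

numModels-cong : ∀ m {P Q : Vector Bool m → Bool} → (∀ x → P x ≡ true ⇔ Q x ≡ true) →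
                 numModels m P ≡ numModels m Q
numModels-cong m P⇔Q = count-cong (allAssign m) (λ x → ⇔→≡ (P⇔Q x))

numModels-cons : ∀ m (P : Vector Bool (suc m) → Bool) →
                 numModels (suc m) P
                 ≡ numModels m (λ x → P (false Vector.∷ x)) + numModels m (λ x → P (true Vector.∷ x))
numModels-cons m P = count-pairs P (false Vector.∷_) (true Vector.∷_) (allAssign m)

numModels-true : ∀ m → numModels m (λ _ → true) ≡ 2 ^ m
numModels-true zero    = refl
numModels-true (suc m) = begin
  numModels (suc m) (λ _ → true)                        ≡⟨ numModels-cons m (λ _ → true) ⟩
  numModels m (λ _ → true) + numModels m (λ _ → true)   ≡⟨ cong₂ _+_ (numModels-true m) (numModels-true m) ⟩
  2 ^ m + 2 ^ m                                         ≡⟨ cong (2 ^ m +_) (+-identityʳ (2 ^ m)) ⟨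
  2 ^ suc m                                             ∎
  where open ≡-Reasoning

infixl 6 _⊕_
_⊕_ : ∀ {m} → Vector Bool m → Vector Bool m → Vector Bool m
(x ⊕ a) i = x i xor a i

numModels-translate : ∀ m {P : Vector Bool m → Bool} → P Preserves _≗_ ⟶ _≡_ →
                      ∀ a → numModels m P ≡ numModels m (λ x → P (x ⊕ a))
numModels-translate zero    P-ext a = count-cong (allAssign zero) (λ x → P-ext {x} {x ⊕ a} (λ ()))
numModels-translate (suc m) {P} P-ext a = begin
  numModels (suc m) P                                ≡⟨ numModels-cons m P ⟩
  #[ false ] + #[ true ]                             ≡⟨ swap (a zero) ⟩
  #[ false xor a zero ] + #[ true xor a zero ]       ≡⟨ cong₂ _+_ (shifted false) (shifted true) ⟨
  numModels m (λ x → P ((false Vector.∷ x) ⊕ a)) + numModels m (λ x → P ((true Vector.∷ x) ⊕ a))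
                                                     ≡⟨ numModels-cons m (λ x → P (x ⊕ a)) ⟨
  numModels (suc m) (λ x → P (x ⊕ a))                ∎
  where
  open ≡-Reasoning
  #[_] : Bool → ℕ
  #[ b ] = numModels m (λ x → P (b Vector.∷ x))
  swap : ∀ b → #[ false ] + #[ true ] ≡ #[ false xor b ] + #[ true xor b ]
  swap false = refl
  swap true  = +-comm #[ false ] #[ true ]
  shifted : ∀ b → numModels m (λ x → P ((b Vector.∷ x) ⊕ a)) ≡ #[ b xor a zero ]
  shifted b = trans (count-cong (allAssign m) (λ x → P-ext λ { zero → refl ; (suc i) → refl }))
                    (sym (numModels-translate m (λ x≗y → P-ext λ { zero → refl ; (suc i) → x≗y i }) (a ∘ suc)))

numModels-fibres : ∀ m N (f : Vector Bool m → Vector Bool N) (P : Vector Bool m → Bool) K →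
                   (∀ d → numModels m (λ x → P x ∧ does (≗-dec Bool._≟_ (f x) d)) ≡ K) →
                   numModels m P ≡ 2 ^ N * K
numModels-fibres m zero f P K fibre = begin
  numModels m P                    ≡⟨ count-cong (allAssign m) (λ x → sym (∧-identityʳ (P x))) ⟩
  numModels m (λ x → P x ∧ true)   ≡⟨ fibre (λ ()) ⟩
  K                                ≡⟨ +-identityʳ K ⟨
  2 ^ zero * K                     ∎
  where open ≡-Reasoning
numModels-fibres m (suc N) f P K fibre = begin
  numModels m P                                    ≡⟨ count-split P (λ x → does (f x zero Bool.≟ false)) (allAssign m) ⟩
  numModels m (P₀ false) + numModels m (λ x → P x ∧ not (does (f x zero Bool.≟ false)))
                                                   ≡⟨ cong (numModels m (P₀ false) +_) (count-cong (allAssign m) λ x →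
                                                        cong (P x ∧_) (not-≟false (f x zero))) ⟩
  numModels m (P₀ false) + numModels m (P₀ true)   ≡⟨ cong₂ _+_ (fibres-below false) (fibres-below true) ⟩
  2 ^ N * K + 2 ^ N * K                            ≡⟨ cong (2 ^ N * K +_) (+-identityʳ (2 ^ N * K)) ⟨
  2 * (2 ^ N * K)                                  ≡⟨ *-assoc 2 (2 ^ N) K ⟨
  2 ^ suc N * K                                    ∎
  where
  open ≡-Reasoning
  P₀ : Bool → Vector Bool m → Bool
  P₀ b x = P x ∧ does (f x zero Bool.≟ b)
  not-≟false : ∀ b → not (does (b Bool.≟ false)) ≡ does (b Bool.≟ true)
  not-≟false false = refl
  not-≟false true  = refl
  fibres-below : ∀ b → numModels m (P₀ b) ≡ 2 ^ N * K
  fibres-below b = numModels-fibres m N (Vector.tail ∘ f) (P₀ b) K λ d →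
    trans (count-cong (allAssign m) (λ x → ∧-assoc (P x) _ _)) (fibre (b Vector.∷ d))

2^m≡2^a*K⇒K≡2^[m∸a] : ∀ m a K → 2 ^ m ≡ 2 ^ a * K → K ≡ 2 ^ (m ∸ a)
2^m≡2^a*K⇒K≡2^[m∸a] m       zero    K eq = sym (trans eq (+-identityʳ K))
2^m≡2^a*K⇒K≡2^[m∸a] zero    (suc a) K eq = ⊥-elim (1≢2* (2 ^ a * K) (trans eq (*-assoc 2 (2 ^ a) K)))
  where
  1≢2* : ∀ y → 1 ≢ 2 * y
  1≢2* zero    ()
  1≢2* (suc y) eq = m+1+n≢0 y (sym (suc-injective eq))
2^m≡2^a*K⇒K≡2^[m∸a] (suc m) (suc a) K eq =
  2^m≡2^a*K⇒K≡2^[m∸a] m a K (*-cancelˡ-≡ (2 ^ m) (2 ^ a * K) 2 (trans eq (*-assoc 2 (2 ^ a) K)))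

-- Tseitin formulas of connected graphs

Loopless : ∀ {n m} → (Fin m → Fin n × Fin n) → Set
Loopless ends = ∀ e → proj₁ (ends e) ≢ proj₂ (ends e)

incident≡∨ : ∀ {n m} (ends : Fin m → Fin n × Fin n) e u →
             incident ends e u ≡ ⌊ proj₁ (ends e) ≟ u ⌋ ∨ ⌊ proj₂ (ends e) ≟ u ⌋
incident≡∨ ends e u with ⌊ proj₁ (ends e) ≟ u ⌋ | ⌊ proj₂ (ends e) ≟ u ⌋
... | false | false = refl
... | false | true  = refl
... | true  | _     = refl

incident-∧-other : ∀ {n m} (ends : Fin m → Fin n × Fin n) → Loopless ends → ∀ e v (Q : Fin n → Bool) →
                   (⌊ proj₁ (ends e) ≟ v ⌋ ∧ Q (proj₂ (ends e))) ∨ (⌊ proj₂ (ends e) ≟ v ⌋ ∧ Q (proj₁ (ends e)))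
                   ≡ incident ends e v ∧ Q (other ends e v)
incident-∧-other ends loopless e v Q rewrite incident≡∨ ends e v with proj₁ (ends e) ≟ v | proj₂ (ends e) ≟ v
... | yes p≡v | yes q≡v = ⊥-elim (loopless e (trans p≡v (sym q≡v)))
... | yes _   | no _    = ∨-identityʳ _
... | no _    | yes _   = refl
... | no _    | no _    = refl

module Tseitin {n m} (ends : Fin m → Fin n × Fin n) (loopless : Loopless ends) where

  ∂ : Vector Bool m → Vector Bool n
  ∂ x u = ∑[ e < m ] (incident ends e u ∧ x e)

  satT⇔ : ∀ c x → satT ends c x ≡ true ⇔ ∂ x ≗ c
  satT⇔ c x = allB-parityWhere⇔ (λ u e → incident ends e u) c x

  ∂-cong : ∀ {x y} → x ≗ y → ∂ x ≗ ∂ y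
  ∂-cong x≗y u = sum-cong-≗ (λ e → cong (incident ends e u ∧_) (x≗y e))

  ∂-⊕ : ∀ x y u → ∂ (x ⊕ y) u ≡ ∂ x u xor ∂ y u
  ∂-⊕ x y u = trans (sum-cong-≗ (λ e → ∧-distribˡ-xor (incident ends e u) (x e) (y e)))
                    (∑-distrib-+ (λ e → incident ends e u ∧ x e) (λ e → incident ends e u ∧ y e))

  ∂-∑ : ∀ {k} (d : Fin k → Bool) (y : Fin k → Vector Bool m) u →
        ∂ (λ e → ∑[ j < k ] (d j ∧ y j e)) u ≡ ∑[ j < k ] (d j ∧ ∂ (y j) u)
  ∂-∑ {k} d y u = begin
    ∑[ e < m ] (incident ends e u ∧ ∑[ j < k ] (d j ∧ y j e))
      ≡⟨ sum-cong-≗ (λ e → *-distribˡ-sum (incident ends e u) (λ j → d j ∧ y j e)) ⟩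
    ∑[ e < m ] ∑[ j < k ] (incident ends e u ∧ (d j ∧ y j e))
      ≡⟨ ∑-comm (λ e j → incident ends e u ∧ (d j ∧ y j e)) ⟩
    ∑[ j < k ] ∑[ e < m ] (incident ends e u ∧ (d j ∧ y j e))
      ≡⟨ sum-cong-≗ (λ j → sum-cong-≗ (λ e → x∙yz≈y∙xz (incident ends e u) (d j) (y j e))) ⟩
    ∑[ j < k ] ∑[ e < m ] (d j ∧ (incident ends e u ∧ y j e))
      ≡⟨ sum-cong-≗ (λ j → *-distribˡ-sum (d j) (λ e → incident ends e u ∧ y j e)) ⟨
    ∑[ j < k ] (d j ∧ ∂ (y j) u)
      ∎
    where open ≡-Reasoning

  incident≡xor : ∀ e u → incident ends e u ≡ ⌊ proj₁ (ends e) ≟ u ⌋ xor ⌊ proj₂ (ends e) ≟ u ⌋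
  incident≡xor e u with proj₁ (ends e) ≟ u | proj₂ (ends e) ≟ u | incident≡∨ ends e u
  ... | yes p≡u | yes q≡u | _  = ⊥-elim (loopless e (trans p≡u (sym q≡u)))
  ... | yes _   | no _    | eq = eq
  ... | no _    | yes _   | eq = eq
  ... | no _    | no _    | eq = eq

  handshake : ∀ x → ∑[ u < n ] ∂ x u ≡ false
  handshake x = begin
    ∑[ u < n ] ∑[ e < m ] (incident ends e u ∧ x e)
      ≡⟨ ∑-comm (λ u e → incident ends e u ∧ x e) ⟩
    ∑[ e < m ] ∑[ u < n ] (incident ends e u ∧ x e)
      ≡⟨ sum-cong-≗ (λ e → *-distribʳ-sum (x e) (λ u → incident ends e u)) ⟨
    ∑[ e < m ] ((∑[ u < n ] incident ends e u) ∧ x e)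
      ≡⟨ ∑-zero (λ e → cong (_∧ x e) (two-ends e)) ⟩
    false
      ∎
    where
    open ≡-Reasoning
    two-ends : ∀ e → ∑[ u < n ] incident ends e u ≡ false
    two-ends e = trans (sum-cong-≗ (incident≡xor e))
                       (trans (∑-distrib-+ (λ u → ⌊ proj₁ (ends e) ≟ u ⌋) (λ u → ⌊ proj₂ (ends e) ≟ u ⌋))
                              (cong₂ _xor_ (∑-⌊≟⌋ (proj₁ (ends e))) (∑-⌊≟⌋ (proj₂ (ends e)))))

  satisfiable⇒even : ∀ c x → satT ends c x ≡ true → ∑[ u < n ] c u ≡ false
  satisfiable⇒even c x sat = trans (sum-cong-≗ (λ u → sym (to (satT⇔ c x) sat u))) (handshake x)

  walk-boundary : ∀ {r u} → Reach ends r u → ∃ λ p → ∀ w → ∂ p w ≡ ⌊ r ≟ w ⌋ xor ⌊ u ≟ w ⌋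
  walk-boundary {r} here = (λ _ → false) , λ w →
    trans (∑-zero (λ e → ∧-zeroʳ (incident ends e w))) (sym (xor-same ⌊ r ≟ w ⌋))
  walk-boundary {r} (step {u} {v} r⇝u (e , e≡uv)) with walk-boundary r⇝u
  ... | p , ∂p = p ⊕ δₑ , λ w → begin
    ∂ (p ⊕ δₑ) w
      ≡⟨ ∂-⊕ p δₑ w ⟩
    ∂ p w xor ∂ δₑ w
      ≡⟨ cong₂ _xor_ (∂p w) (trans (∑-δ _ e) (edge w e≡uv)) ⟩
    (⌊ r ≟ w ⌋ xor ⌊ u ≟ w ⌋) xor (⌊ u ≟ w ⌋ xor ⌊ v ≟ w ⌋)
      ≡⟨ xor-assoc ⌊ r ≟ w ⌋ _ _ ⟩
    ⌊ r ≟ w ⌋ xor (⌊ u ≟ w ⌋ xor (⌊ u ≟ w ⌋ xor ⌊ v ≟ w ⌋))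
      ≡⟨ cong (⌊ r ≟ w ⌋ xor_) (xor-cancelˡ ⌊ u ≟ w ⌋ _) ⟩
    ⌊ r ≟ w ⌋ xor ⌊ v ≟ w ⌋
      ∎
    where
    open ≡-Reasoning
    δₑ : Vector Bool m
    δₑ i = ⌊ i ≟ e ⌋
    edge : ∀ w → (ends e ≡ (u , v)) ⊎ (ends e ≡ (v , u)) → incident ends e w ≡ ⌊ u ≟ w ⌋ xor ⌊ v ≟ w ⌋
    edge w (inj₁ refl) = incident≡xor e w
    edge w (inj₂ refl) = trans (incident≡xor e w) (xor-comm ⌊ v ≟ w ⌋ ⌊ u ≟ w ⌋)

  even⇒boundary : ∀ {r} → (∀ u → Reach ends r u) → ∀ c → ∑[ u < n ] c u ≡ false → ∃ λ x → ∂ x ≗ c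
  even⇒boundary {r} r⇝ c even = x , λ w → begin
    ∂ x w
      ≡⟨ ∂-∑ c p w ⟩
    ∑[ u < n ] (c u ∧ ∂ (p u) w)
      ≡⟨ sum-cong-≗ (λ u → cong (c u ∧_) (proj₂ (walk-boundary (r⇝ u)) w)) ⟩
    ∑[ u < n ] (c u ∧ (⌊ r ≟ w ⌋ xor ⌊ u ≟ w ⌋))
      ≡⟨ sum-cong-≗ (λ u → ∧-distribˡ-xor (c u) _ _) ⟩
    ∑[ u < n ] ((c u ∧ ⌊ r ≟ w ⌋) xor (c u ∧ ⌊ u ≟ w ⌋))
      ≡⟨ ∑-distrib-+ (λ u → c u ∧ ⌊ r ≟ w ⌋) (λ u → c u ∧ ⌊ u ≟ w ⌋) ⟩
    ∑[ u < n ] (c u ∧ ⌊ r ≟ w ⌋) xor ∑[ u < n ] (c u ∧ ⌊ u ≟ w ⌋)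
      ≡⟨ cong₂ _xor_ (sym (*-distribʳ-sum ⌊ r ≟ w ⌋ c)) (∑-δ c w) ⟩
    (∑[ u < n ] c u ∧ ⌊ r ≟ w ⌋) xor c w
      ≡⟨ cong (λ s → (s ∧ ⌊ r ≟ w ⌋) xor c w) even ⟩
    c w
      ∎
    where
    open ≡-Reasoning
    p : Fin n → Vector Bool m
    p u = proj₁ (walk-boundary (r⇝ u))
    x : Vector Bool m
    x e = ∑[ u < n ] (c u ∧ p u e)

  satT-cong : ∀ c → satT ends c Preserves _≗_ ⟶ _≡_
  satT-cong c {x} {y} x≗y = ⇔→≡ (begin
    satT ends c x ≡ true  ∼⟨ satT⇔ c x ⟩
    ∂ x ≗ c               ∼⟨ ∀-cong-⇔ (λ u → mk⇔ (trans (sym (∂-cong x≗y u))) (trans (∂-cong x≗y u))) ⟩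
    ∂ y ≗ c               ∼⟨ ⇔-sym (satT⇔ c y) ⟩
    satT ends c y ≡ true  ∎)
    where open EquationalReasoning {k = Kind.equivalence}

  numModels-satT-charge-invariant : ∀ {c c′ x₀ x₁} → ∂ x₀ ≗ c → ∂ x₁ ≗ c′ →
                                    numModels m (satT ends c) ≡ numModels m (satT ends c′)
  numModels-satT-charge-invariant {c} {c′} {x₀} {x₁} ∂x₀≗c ∂x₁≗c′ =
    trans (numModels-translate m (satT-cong c) (x₀ ⊕ x₁)) (numModels-cong m shifted)
    where
    ∂-shift : ∀ x u → ∂ (x ⊕ (x₀ ⊕ x₁)) u ≡ ∂ x u xor (c u xor c′ u)
    ∂-shift x u = trans (∂-⊕ x (x₀ ⊕ x₁) u)
                        (cong (∂ x u xor_) (trans (∂-⊕ x₀ x₁ u) (cong₂ _xor_ (∂x₀≗c u) (∂x₁≗c′ u))))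
    shifted : ∀ x → satT ends c (x ⊕ (x₀ ⊕ x₁)) ≡ true ⇔ satT ends c′ x ≡ true
    shifted x = begin
      satT ends c (x ⊕ (x₀ ⊕ x₁)) ≡ true
        ∼⟨ satT⇔ c _ ⟩
      (∀ u → ∂ (x ⊕ (x₀ ⊕ x₁)) u ≡ c u)
        ∼⟨ ∀-cong-⇔ (λ u → mk⇔ (trans (sym (∂-shift x u))) (trans (∂-shift x u))) ⟩
      (∀ u → ∂ x u xor (c u xor c′ u) ≡ c u)
        ∼⟨ ∀-cong-⇔ (λ u → xor≡⇔≡xor) ⟩
      (∀ u → ∂ x u ≡ c u xor (c u xor c′ u))
        ∼⟨ ∀-cong-⇔ (λ u → mk⇔ (λ eq → trans eq (xor-cancelˡ (c u) (c′ u)))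
                                (λ eq → trans eq (sym (xor-cancelˡ (c u) (c′ u))))) ⟩
      ∂ x ≗ c′
        ∼⟨ ⇔-sym (satT⇔ c′ x) ⟩
      satT ends c′ x ≡ true
        ∎
      where open EquationalReasoning {k = Kind.equivalence}

tseitin-count : ∀ {n m} (ends : Fin m → Fin n × Fin n) → Loopless ends → Connected (Fin n) ends →
                ∀ c → ∑[ u < n ] c u ≡ false → numModels m (satT ends c) ≡ 2 ^ (m + 1 ∸ n)
tseitin-count {zero} ends _ (() , _)
tseitin-count {suc n} {m} ends loopless (_ , reach) c even = begin
  numModels m (satT ends c)  ≡⟨ 2^m≡2^a*K⇒K≡2^[m∸a] m n _ 2^m≡2^n*K ⟩
  2 ^ (m ∸ n)                ≡⟨ cong (λ k → 2 ^ (k ∸ suc n)) (+-comm 1 m) ⟩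
  2 ^ (m + 1 ∸ suc n)        ∎
  where
  open ≡-Reasoning
  open Tseitin ends loopless
  -- the handshake lemma determines ∂ x at the root from the other vertices, so prescribing ∂ x off
  -- the root to be d is the same as prescribing the even charge (Σ d) ∷ d everywhere
  fibre⇔ : ∀ d x → does (≗-dec Bool._≟_ (Vector.tail (∂ x)) d) ≡ true ⇔ satT ends (sum d Vector.∷ d) x ≡ true
  fibre⇔ d x = mk⇔
    (λ h → let ∂x≗d = to (does⇔ (≗-dec Bool._≟_ (Vector.tail (∂ x)) d)) h in
       from (satT⇔ _ x) λ { zero → trans (to xor≡⇔≡xor (handshake x)) (sum-cong-≗ ∂x≗d) ; (suc j) → ∂x≗d j })
    (λ h → from (does⇔ (≗-dec Bool._≟_ (Vector.tail (∂ x)) d)) (to (satT⇔ _ x) h ∘ suc))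
  fibre : ∀ d → numModels m (λ x → does (≗-dec Bool._≟_ (Vector.tail (∂ x)) d)) ≡ numModels m (satT ends c)
  fibre d = trans (numModels-cong m (fibre⇔ d))
                  (numModels-satT-charge-invariant (proj₂ (even⇒boundary (reach zero) _ (xor-same (sum d))))
                                                   (proj₂ (even⇒boundary (reach zero) c even)))
  2^m≡2^n*K : 2 ^ m ≡ 2 ^ n * numModels m (satT ends c)
  2^m≡2^n*K = trans (sym (numModels-true m)) (numModels-fibres m n (Vector.tail ∘ ∂) (λ _ → true) _ fibre)

-- Splitting vertices

findIdx-just : ∀ {n} k (vs : Fin k → Fin n) {a i} → findIdx k vs a ≡ just i → vs i ≡ a
findIdx-just (suc k) vs {a} eq with vs zero ≟ a
findIdx-just (suc k) vs {a} refl | yes v₀≡a = v₀≡a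
... | no _ with findIdx k (vs ∘ suc) a in eq′
findIdx-just (suc k) vs {a} refl | no _ | just i = findIdx-just k (vs ∘ suc) eq′

findIdx-nothing : ∀ {n} k (vs : Fin k → Fin n) {a} → findIdx k vs a ≡ nothing → ∀ i → vs i ≢ a
findIdx-nothing (suc k) vs {a} eq i vᵢ≡a with vs zero ≟ a
findIdx-nothing (suc k) vs {a} () i vᵢ≡a | yes _
... | no v₀≢a with findIdx k (vs ∘ suc) a in eq′
findIdx-nothing (suc k) vs {a} refl zero    vᵢ≡a | no v₀≢a | nothing = v₀≢a vᵢ≡a
findIdx-nothing (suc k) vs {a} refl (suc i) vᵢ≡a | no v₀≢a | nothing = findIdx-nothing k (vs ∘ suc) eq′ i vᵢ≡a

findIdx-view : ∀ {n} k (vs : Fin k → Fin n) a → findIdx k vs a ≡ nothing ⊎ ∃ λ i → vs i ≡ a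
findIdx-view k vs a with findIdx k vs a in eq
... | nothing = inj₁ refl
... | just i  = inj₂ (i , findIdx-just k vs eq)

findIdx-injective : ∀ {n} k {vs : Fin k → Fin n} → Injective _≡_ _≡_ vs → ∀ i → findIdx k vs (vs i) ≡ just i
findIdx-injective k {vs} vs-injective i with findIdx k vs (vs i) in eq
... | just j  = cong just (vs-injective (findIdx-just k vs eq))
... | nothing = ⊥-elim (findIdx-nothing k vs eq i refl)

join-injective : ∀ n k {p q : Fin n ⊎ Fin k} → join n k p ≡ join n k q → p ≡ q
join-injective n k {p} {q} eq = trans (sym (splitAt-join n k p)) (trans (cong (splitAt n) eq) (splitAt-join n k q))

module Splitting {n m k} (ends : Fin m → Fin n × Fin n) (loopless : Loopless ends)
                 (vs : Fin k → Fin n) (vs-injective : Injective _≡_ _≡_ vs) (N1 : Fin k → Fin n → Bool) where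

  open Tseitin ends loopless

  parityInto : Fin n → (Fin n → Bool) → Vector Bool m → Bool
  parityInto v Q x = ∑[ e < m ] ((incident ends e v ∧ Q (other ends e v)) ∧ x e)

  parityInto-cong : ∀ v {Q Q′} → Q ≗ Q′ → ∀ x → parityInto v Q x ≡ parityInto v Q′ x
  parityInto-cong v Q≗Q′ x = sum-cong-≗ (λ e → cong (λ b → (incident ends e v ∧ b) ∧ x e) (Q≗Q′ (other ends e v)))

  parityInto-all : ∀ v x → parityInto v (λ _ → true) x ≡ ∂ x v
  parityInto-all v x = sum-cong-≗ (λ e → cong (_∧ x e) (∧-identityʳ (incident ends e v)))

  ∂≡parityInto-xor : ∀ v Q x → ∂ x v ≡ parityInto v Q x xor parityInto v (not ∘ Q) x
  ∂≡parityInto-xor v Q x =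
    trans (sum-cong-≗ (λ e → split (incident ends e v) (Q (other ends e v)) (x e)))
          (∑-distrib-+ (λ e → (incident ends e v ∧ Q (other ends e v)) ∧ x e)
                       (λ e → (incident ends e v ∧ not (Q (other ends e v))) ∧ x e))
    where
    split : ∀ a b y → a ∧ y ≡ ((a ∧ b) ∧ y) xor ((a ∧ not b) ∧ y)
    split true  true  y = sym (xor-identityʳ y)
    split true  false y = refl
    split false b     y = refl

  -- Vertex w of the split graph replaces base w; an edge from base w to b is attached to w iff side w b.
  base : Fin n ⊎ Fin k → Fin n
  base (inj₁ u) = u
  base (inj₂ i) = vs i

  side : Fin n ⊎ Fin k → Fin n → Bool
  side (inj₁ u) b = maybe′ (λ i → N1 i b) true (findIdx k vs u)
  side (inj₂ i) b = not (N1 i b)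

  base-newEnd : ∀ a b → base (newEnd vs N1 a b) ≡ a
  base-newEnd a b with findIdx k vs a in eq
  ... | nothing = refl
  ... | just i with N1 i b
  ...   | true  = refl
  ...   | false = findIdx-just k vs eq

  side-newEnd : ∀ a b → side (newEnd vs N1 a b) b ≡ true
  side-newEnd a b with findIdx k vs a in eq
  ... | nothing = cong (maybe′ (λ i → N1 i b) true) eq
  ... | just i with N1 i b in N1ib
  ...   | true  = trans (cong (maybe′ (λ i → N1 i b) true) eq) N1ib
  ...   | false = cong not N1ib

  newEnd-base : ∀ w b → side w b ≡ true → newEnd vs N1 (base w) b ≡ w
  newEnd-base (inj₁ u) b side≡true with findIdx k vs u
  ... | nothing = refl
  ... | just i rewrite side≡true = refl
  newEnd-base (inj₂ i) b side≡true rewrite findIdx-injective k vs-injective i with N1 i b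
  ... | false = refl
  newEnd-base (inj₂ i) b () | true

  newEnd≡⇔ : ∀ a b w → newEnd vs N1 a b ≡ w ⇔ (a ≡ base w × T (side w b))
  newEnd≡⇔ a b w = mk⇔ (λ { refl → sym (base-newEnd a b) , from T-≡ (side-newEnd a b) })
                       (λ { (refl , side-w-b) → newEnd-base w b (to T-≡ side-w-b) })

  ⌊join-newEnd≟join⌋ : ∀ a b w → ⌊ join n k (newEnd vs N1 a b) ≟ join n k w ⌋ ≡ ⌊ a ≟ base w ⌋ ∧ side w b
  ⌊join-newEnd≟join⌋ a b w = begin
    ⌊ join n k (newEnd vs N1 a b) ≟ join n k w ⌋     ≡⟨ isYes≗does (join n k (newEnd vs N1 a b) ≟ join n k w) ⟩
    does (join n k (newEnd vs N1 a b) ≟ join n k w)  ≡⟨ does-⇔ join≡⇔ (join n k (newEnd vs N1 a b) ≟ join n k w)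
                                                                     ((a ≟ base w) ×-dec T? (side w b)) ⟩
    does (a ≟ base w) ∧ side w b                     ≡⟨ cong (_∧ side w b) (isYes≗does (a ≟ base w)) ⟨
    ⌊ a ≟ base w ⌋ ∧ side w b                        ∎
    where
    open ≡-Reasoning
    join≡⇔ : join n k (newEnd vs N1 a b) ≡ join n k w ⇔ (a ≡ base w × T (side w b))
    join≡⇔ = mk⇔ (to (newEnd≡⇔ a b w) ∘ join-injective n k) (cong (join n k) ∘ from (newEnd≡⇔ a b w))

  -- The split graph, with vertex set Fin n ⊎ Fin k flattened to Fin (n + k) so that satT applies to it.
  splitEnds′ : Fin m → Fin (n + k) × Fin (n + k)
  splitEnds′ e = join n k (proj₁ (splitEnds ends vs N1 e)) , join n k (proj₂ (splitEnds ends vs N1 e))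

  splitEnds′-loopless : Loopless splitEnds′
  splitEnds′-loopless e eq = loopless e (begin
    a                        ≡⟨ base-newEnd a b ⟨
    base (newEnd vs N1 a b)  ≡⟨ cong base (join-injective n k {newEnd vs N1 a b} {newEnd vs N1 b a} eq) ⟩
    base (newEnd vs N1 b a)  ≡⟨ base-newEnd b a ⟩
    b                        ∎)
    where
    open ≡-Reasoning
    a = proj₁ (ends e)
    b = proj₂ (ends e)

  splitEnds′-connected : Connected (Fin n ⊎ Fin k) (splitEnds ends vs N1) → Connected (Fin (n + k)) splitEnds′
  splitEnds′-connected (w , reach) = join n k w , λ a b →
    subst₂ (Reach splitEnds′) (join-splitAt n k a) (join-splitAt n k b) (reach-join (reach (splitAt n a) (splitAt n b)))
    where
    adj-join : ∀ {u v} → Adj (splitEnds ends vs N1) u v → Adj splitEnds′ (join n k u) (join n k v)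
    adj-join (e , inj₁ eq) = e , inj₁ (cong (Product.map (join n k) (join n k)) eq)
    adj-join (e , inj₂ eq) = e , inj₂ (cong (Product.map (join n k) (join n k)) eq)
    reach-join : ∀ {u v} → Reach (splitEnds ends vs N1) u v → Reach splitEnds′ (join n k u) (join n k v)
    reach-join here             = here
    reach-join (step u⇝v v~w) = step (reach-join u⇝v) (adj-join v~w)

  incident-splitEnds′ : ∀ e w → incident splitEnds′ e (join n k w)
                                ≡ incident ends e (base w) ∧ side w (other ends e (base w))
  incident-splitEnds′ e w = begin
    incident splitEnds′ e (join n k w)
      ≡⟨ incident≡∨ splitEnds′ e (join n k w) ⟩
    ⌊ join n k (newEnd vs N1 a b) ≟ join n k w ⌋ ∨ ⌊ join n k (newEnd vs N1 b a) ≟ join n k w ⌋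
      ≡⟨ cong₂ _∨_ (⌊join-newEnd≟join⌋ a b w) (⌊join-newEnd≟join⌋ b a w) ⟩
    (⌊ a ≟ base w ⌋ ∧ side w b) ∨ (⌊ b ≟ base w ⌋ ∧ side w a)
      ≡⟨ incident-∧-other ends loopless e (base w) (side w) ⟩
    incident ends e (base w) ∧ side w (other ends e (base w))
      ∎
    where
    open ≡-Reasoning
    a = proj₁ (ends e)
    b = proj₂ (ends e)

  module Split = Tseitin splitEnds′ splitEnds′-loopless

  ∂′-join : ∀ x w → Split.∂ x (join n k w) ≡ parityInto (base w) (side w) x
  ∂′-join x w = sum-cong-≗ (λ e → cong (_∧ x e) (incident-splitEnds′ e w))

  ∂′-outside : ∀ {u} → findIdx k vs u ≡ nothing → ∀ x → Split.∂ x (join n k (inj₁ u)) ≡ ∂ x u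
  ∂′-outside {u} eq x = trans (∂′-join x (inj₁ u))
    (trans (parityInto-cong u (λ b → cong (maybe′ (λ i → N1 i b) true) eq) x) (parityInto-all u x))

  ∂′-v¹ : ∀ i x → Split.∂ x (join n k (inj₁ (vs i))) ≡ parityInto (vs i) (N1 i) x
  ∂′-v¹ i x = trans (∂′-join x (inj₁ (vs i)))
    (parityInto-cong (vs i) (λ b → cong (maybe′ (λ i → N1 i b) true) (findIdx-injective k vs-injective i)) x)

  ∂′-v² : ∀ i x → Split.∂ x (join n k (inj₂ i)) ≡ parityInto (vs i) (not ∘ N1 i) x
  ∂′-v² i x = ∂′-join x (inj₂ i)

  splitCharge : (Fin n → Bool) → (Fin k → Bool) → Fin n ⊎ Fin k → Bool
  splitCharge c ci (inj₁ u) = maybe′ ci (c u) (findIdx k vs u)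
  splitCharge c ci (inj₂ i) = c (vs i) xor ci i

  split-models⇔ : ∀ c ci x → (∂ x ≗ c × (∀ i → parityInto (vs i) (N1 i) x ≡ ci i))
                             ⇔ Split.∂ x ≗ splitCharge c ci ∘ splitAt n
  split-models⇔ c ci x = mk⇔ models⇒split split⇒models
    where
    ∂-vᵢ : ∀ i → ∂ x (vs i) ≡ parityInto (vs i) (N1 i) x xor parityInto (vs i) (not ∘ N1 i) x
    ∂-vᵢ i = ∂≡parityInto-xor (vs i) (N1 i) x
    charge-v¹ : ∀ i → splitCharge c ci (inj₁ (vs i)) ≡ ci i
    charge-v¹ i = cong (maybe′ ci (c (vs i))) (findIdx-injective k vs-injective i)

    models⇒split : (∂ x ≗ c × (∀ i → parityInto (vs i) (N1 i) x ≡ ci i))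
                   → Split.∂ x ≗ splitCharge c ci ∘ splitAt n
    models⇒split (∂x≗c , χ) w′ = trans (cong (Split.∂ x) (sym (join-splitAt n k w′))) (at-join (splitAt n w′))
      where
      at-join : ∀ w → Split.∂ x (join n k w) ≡ splitCharge c ci w
      at-join (inj₁ u) with findIdx-view k vs u
      ... | inj₁ eq         = trans (∂′-outside eq x) (trans (∂x≗c u) (sym (cong (maybe′ ci (c u)) eq)))
      ... | inj₂ (i , refl) = trans (∂′-v¹ i x) (trans (χ i) (sym (charge-v¹ i)))
      at-join (inj₂ i) = begin
        Split.∂ x (join n k (inj₂ i))     ≡⟨ ∂′-v² i x ⟩
        parityInto (vs i) (not ∘ N1 i) x  ≡⟨ xor-cancelˡ (parityInto (vs i) (N1 i) x) _ ⟨
        parityInto (vs i) (N1 i) x xor (parityInto (vs i) (N1 i) x xor parityInto (vs i) (not ∘ N1 i) x)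
                                          ≡⟨ cong₂ _xor_ (χ i) (trans (sym (∂-vᵢ i)) (∂x≗c (vs i))) ⟩
        ci i xor c (vs i)                 ≡⟨ xor-comm (ci i) (c (vs i)) ⟩
        c (vs i) xor ci i                 ∎
        where open ≡-Reasoning

    split⇒models : Split.∂ x ≗ splitCharge c ci ∘ splitAt n
                   → (∂ x ≗ c × (∀ i → parityInto (vs i) (N1 i) x ≡ ci i))
    split⇒models ∂′x≗c′ = ∂x≗c , χ
      where
      at-join : ∀ w → Split.∂ x (join n k w) ≡ splitCharge c ci w
      at-join w = trans (∂′x≗c′ (join n k w)) (cong (splitCharge c ci) (splitAt-join n k w))
      χ : ∀ i → parityInto (vs i) (N1 i) x ≡ ci i
      χ i = trans (sym (∂′-v¹ i x)) (trans (at-join (inj₁ (vs i))) (charge-v¹ i))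
      ∂x≗c : ∂ x ≗ c
      ∂x≗c u with findIdx-view k vs u
      ... | inj₁ eq         = trans (sym (∂′-outside eq x)) (trans (at-join (inj₁ u)) (cong (maybe′ ci (c u)) eq))
      ... | inj₂ (i , refl) = begin
        ∂ x (vs i)
          ≡⟨ ∂-vᵢ i ⟩
        parityInto (vs i) (N1 i) x xor parityInto (vs i) (not ∘ N1 i) x
          ≡⟨ cong₂ _xor_ (χ i) (trans (sym (∂′-v² i x)) (at-join (inj₂ i))) ⟩
        ci i xor (c (vs i) xor ci i)
          ≡⟨ cong (ci i xor_) (xor-comm (c (vs i)) (ci i)) ⟩
        ci i xor (ci i xor c (vs i))
          ≡⟨ xor-cancelˡ (ci i) (c (vs i)) ⟩
        c (vs i)
          ∎
        where open ≡-Reasoning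

  splitCharge-inj₁ : ∀ c ci u →
                     splitCharge c ci (inj₁ u) ≡ c u xor ∑[ j < k ] ((c (vs j) xor ci j) ∧ ⌊ vs j ≟ u ⌋)
  splitCharge-inj₁ c ci u with findIdx-view k vs u
  ... | inj₁ eq = begin
    maybe′ ci (c u) (findIdx k vs u)
      ≡⟨ cong (maybe′ ci (c u)) eq ⟩
    c u
      ≡⟨ xor-identityʳ (c u) ⟨
    c u xor false
      ≡⟨ cong (c u xor_) (∑-zero λ j → trans (cong ((c (vs j) xor ci j) ∧_) (vs≢u j)) (∧-zeroʳ _)) ⟨
    c u xor ∑[ j < k ] ((c (vs j) xor ci j) ∧ ⌊ vs j ≟ u ⌋)
      ∎
    where
    open ≡-Reasoning
    vs≢u : ∀ j → ⌊ vs j ≟ u ⌋ ≡ false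
    vs≢u j = trans (isYes≗does (vs j ≟ u)) (dec-false (vs j ≟ u) (findIdx-nothing k vs eq j))
  ... | inj₂ (i , refl) = begin
    maybe′ ci (c (vs i)) (findIdx k vs (vs i))
      ≡⟨ cong (maybe′ ci (c (vs i))) (findIdx-injective k vs-injective i) ⟩
    ci i
      ≡⟨ xor-cancelˡ (c (vs i)) (ci i) ⟨
    c (vs i) xor (c (vs i) xor ci i)
      ≡⟨ cong (c (vs i) xor_) (∑-δ (λ j → c (vs j) xor ci j) i) ⟨
    c (vs i) xor ∑[ j < k ] ((c (vs j) xor ci j) ∧ ⌊ j ≟ i ⌋)
      ≡⟨ cong (c (vs i) xor_) (sum-cong-≗ λ j → cong ((c (vs j) xor ci j) ∧_) (⌊vs≟vs⌋ j)) ⟨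
    c (vs i) xor ∑[ j < k ] ((c (vs j) xor ci j) ∧ ⌊ vs j ≟ vs i ⌋)
      ∎
    where
    open ≡-Reasoning
    ⌊vs≟vs⌋ : ∀ j → ⌊ vs j ≟ vs i ⌋ ≡ ⌊ j ≟ i ⌋
    ⌊vs≟vs⌋ j = ⌊⌋-⇔ (mk⇔ vs-injective (cong vs)) (vs j ≟ vs i) (j ≟ i)

  splitCharge-even : ∀ c ci → ∑[ u < n ] c u ≡ false → ∑[ w < n + k ] splitCharge c ci (splitAt n w) ≡ false
  splitCharge-even c ci even = begin
    ∑[ w < n + k ] splitCharge c ci (splitAt n w)
      ≡⟨ ∑-splitAt n k (splitCharge c ci) ⟩
    ∑[ u < n ] splitCharge c ci (inj₁ u) xor ∑[ j < k ] d j
      ≡⟨ cong (_xor ∑[ j < k ] d j) (sum-cong-≗ (splitCharge-inj₁ c ci)) ⟩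
    ∑[ u < n ] (c u xor ∑[ j < k ] (d j ∧ ⌊ vs j ≟ u ⌋)) xor ∑[ j < k ] d j
      ≡⟨ cong (_xor ∑[ j < k ] d j) (∑-distrib-+ c (λ u → ∑[ j < k ] (d j ∧ ⌊ vs j ≟ u ⌋))) ⟩
    (∑[ u < n ] c u xor ∑[ u < n ] ∑[ j < k ] (d j ∧ ⌊ vs j ≟ u ⌋)) xor ∑[ j < k ] d j
      ≡⟨ cong (λ s → (∑[ u < n ] c u xor s) xor ∑[ j < k ] d j) each-vᵢ-once ⟩
    (∑[ u < n ] c u xor ∑[ j < k ] d j) xor ∑[ j < k ] d j
      ≡⟨ xor-involutiveʳ _ _ ⟩
    ∑[ u < n ] c u
      ≡⟨ even ⟩
    false
      ∎
    where
    open ≡-Reasoning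
    d : Fin k → Bool
    d j = c (vs j) xor ci j
    each-vᵢ-once : ∑[ u < n ] ∑[ j < k ] (d j ∧ ⌊ vs j ≟ u ⌋) ≡ ∑[ j < k ] d j
    each-vᵢ-once = trans (∑-comm (λ u j → d j ∧ ⌊ vs j ≟ u ⌋)) (sum-cong-≗ λ j →
      trans (sym (*-distribˡ-sum (d j) (λ u → ⌊ vs j ≟ u ⌋)))
            (trans (cong (d j ∧_) (∑-⌊≟⌋ (vs j))) (∧-identityʳ (d j))))

  formula⇔satT-split : ∀ c ci x →
                       satT ends c x ∧ allB (λ i → satChi ends (vs i) (N1 i) (ci i) x) ≡ true
                       ⇔ satT splitEnds′ (splitCharge c ci ∘ splitAt n) x ≡ true
  formula⇔satT-split c ci x = begin
    satT ends c x ∧ allB (λ i → satChi ends (vs i) (N1 i) (ci i) x) ≡ true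
      ∼⟨ ∧≡true⇔ ⟩
    (satT ends c x ≡ true × allB (λ i → satChi ends (vs i) (N1 i) (ci i) x) ≡ true)
      ∼⟨ satT⇔ c x ×-⇔ allB-parityWhere⇔ (λ i e → incident ends e (vs i) ∧ N1 i (other ends e (vs i))) ci x ⟩
    (∂ x ≗ c × (∀ i → parityInto (vs i) (N1 i) x ≡ ci i))
      ∼⟨ split-models⇔ c ci x ⟩
    Split.∂ x ≗ splitCharge c ci ∘ splitAt n
      ∼⟨ ⇔-sym (Split.satT⇔ _ x) ⟩
    satT splitEnds′ (splitCharge c ci ∘ splitAt n) x ≡ true
      ∎
    where open EquationalReasoning {k = Kind.equivalence}

lemma8 : (n m k : ℕ) (ends : Fin m → Fin n × Fin n) → SimpleGraph n m ends →
         Connected (Fin n) ends →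
         (c : Fin n → Bool) → (∃ λ x → satT ends c x ≡ true) →
         (vs : Fin k → Fin n) → Injective _≡_ _≡_ vs →
         (∀ i j → ¬ Adj ends (vs i) (vs j)) →
         (N1 : Fin k → Fin n → Bool) →
         (∀ i → ∃ λ u → Adj ends (vs i) u × N1 i u ≡ true) →
         (∀ i → ∃ λ u → Adj ends (vs i) u × N1 i u ≡ false) →
         (ci : Fin k → Bool) →
         Connected (Fin n ⊎ Fin k) (splitEnds ends vs N1) →
         countModels m (λ x → satT ends c x ∧ allB (λ i → satChi ends (vs i) (N1 i) (ci i) x))
           ≡ 2 ^ (m + 1 ∸ (n + k))
lemma8 n m k ends G _ c (x₀ , x₀⊨T) vs vs-injective _ N1 _ _ ci split-connected = begin
  countModels m φ
    ≡⟨ countModels≡numModels m φ ⟩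
  numModels m φ
    ≡⟨ numModels-cong m (formula⇔satT-split c ci) ⟩
  numModels m (satT splitEnds′ c′)
    ≡⟨ tseitin-count splitEnds′ splitEnds′-loopless (splitEnds′-connected split-connected)
                     c′ (splitCharge-even c ci (satisfiable⇒even c x₀ x₀⊨T)) ⟩
  2 ^ (m + 1 ∸ (n + k))
    ∎
  where
  open ≡-Reasoning
  open Tseitin ends (SimpleGraph.noLoop G)
  open Splitting ends (SimpleGraph.noLoop G) vs vs-injective N1
  φ : Vector Bool m → Bool
  φ x = satT ends c x ∧ allB (λ i → satChi ends (vs i) (N1 i) (ci i) x)
  c′ : Fin (n + k) → Bool
  c′ = splitCharge c ci ∘ splitAt n
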